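{- Let $G=(V,E)$ be a simple, finite, connected reflective graph and let $x\sim y$. Then $V_x^y$ is a convex subset of $V$, and the induced subgraph of $G$ on $V_x^y$ is reflective.
   Context: $d$ is the graph distance. A subset $W\subseteq V$ is convex if every shortest path of $G$ with first and last vertex in $W$ has all its vertices in $W$. For adjacent $x\sim y$ let $V_x^y=\{x': d(x',x)<d(x',y)\}$, $V^{xy}=\{z: d(z,x)=d(z,y)\}$. A reflection from $x$ to $y$ is a graph automorphism $\phi$ with $\phi^2=\mathrm{id}$, $\phi(x)=y$, such that the set of edges between $V_x^y$ and $V_y^x$ is exactly $\{(x',\phi(x')):x'\in V_x^y\}$, and $\phi$ fixes every vertex of $V^{xy}$ (all notions computed in the graph under consideration). A graph is reflective if a reflection from $x$ to $y$ exists for every edge $x\sim y$. -}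

module Defs where

open import Data.Nat using (ℕ; zero; suc; _≤_; _<_)
open import Data.Fin using (Fin)
open import Data.Bool using (Bool; T)
open import Data.Product using (Σ; _×_; _,_; proj₁; ∃-syntax)
open import Data.Empty using (⊥)
open import Relation.Nullary using (¬_; Dec)
open import Relation.Binary.PropositionalEquality using (_≡_)
open import Function.Bundles using (_↔_)

record Graph : Set₁ where
  field
    V      : Set
    Adj    : V → V → Set
    sym    : ∀ {u v} → Adj u v → Adj v u
    irrefl : ∀ {u} → ¬ Adj u u
    dec    : ∀ u v → Dec (Adj u v)

open Graph public

Finite : Graph → Set
Finite G = Σ ℕ (λ n → V G ↔ Fin n)

data Walk (G : Graph) : V G → V G → ℕ → Set where
  nil  : ∀ {u} → Walk G u u 0
  cons : ∀ {u w v k} → Adj G u w → Walk G w v k → Walk G u v (suc k)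

data _∈ᵂ_ {G : Graph} (z : V G) : ∀ {u v k} → Walk G u v k → Set where
  here-nil  : ∀ {u} → z ≡ u → z ∈ᵂ (nil {G} {u})
  here-cons : ∀ {u w v k} {a : Adj G u w} {p : Walk G w v k} → z ≡ u → z ∈ᵂ cons a p
  there     : ∀ {u w v k} {a : Adj G u w} {p : Walk G w v k} → z ∈ᵂ p → z ∈ᵂ cons a p

Connected : Graph → Set
Connected G = ∀ u v → ∃[ k ] Walk G u v k

Dist : (G : Graph) → V G → V G → ℕ → Set
Dist G u v k = Walk G u v k × (∀ m → Walk G u v m → k ≤ m)

Convex : (G : Graph) → (V G → Set) → Set
Convex G W = ∀ {u v k} (p : Walk G u v k) → Dist G u v k →
             W u → W v → ∀ z → z ∈ᵂ p → W z

-- V_x^y = { x' : d(x',x) < d(x',y) }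
Side : (G : Graph) → V G → V G → V G → Set
Side G x y x' = ∃[ a ] ∃[ b ] (Dist G x' x a × Dist G x' y b × a < b)

Mid : (G : Graph) → V G → V G → V G → Set
Mid G x y z = ∃[ a ] (Dist G z x a × Dist G z y a)

record Reflection (G : Graph) (x y : V G) (φ : V G → V G) : Set where
  field
    adj-pres   : ∀ u v → Adj G u v → Adj G (φ u) (φ v)
    adj-refl   : ∀ u v → Adj G (φ u) (φ v) → Adj G u v
    involution : ∀ u → φ (φ u) ≡ u
    maps       : φ x ≡ y
    -- the edges between V_x^y and V_y^x are exactly the pairs (x', φ x'), x' ∈ V_x^y
    cut-mem    : ∀ u → Side G x y u → Side G y x (φ u) × Adj G u (φ u)
    cut-only   : ∀ u v → Side G x y u → Side G y x v → Adj G u v → v ≡ φ u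
    fixes      : ∀ z → Mid G x y z → φ z ≡ z

Reflective : Graph → Set
Reflective G = ∀ x y → Adj G x y → Σ (V G → V G) (Reflection G x y)

Induced : (G : Graph) → (V G → Bool) → Graph
Induced G S = record
  { V      = Σ (V G) (λ v → T (S v))
  ; Adj    = λ a b → Adj G (proj₁ a) (proj₁ b)
  ; sym    = sym G
  ; irrefl = irrefl G
  ; dec    = λ a b → dec G (proj₁ a) (proj₁ b)
  }

-- Let φ be the reflection from x to y. For v ∈ V_x^y let ρ be the reflection
-- from v to φ v; then ρ x = y, so ρ maps V_x^y into V_y^x. Walking from any
-- w ∈ V_x^y towards x inside V_x^y, ρ can never fix w nor send a neighbour
-- to w, hence V_x^y ⊆ V_v^{φ v}, i.e. d(w,v) < d(w,φ v). A geodesic between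
-- two vertices of V_x^y through a vertex fixed by φ, or through z ∈ V_y^x
-- (detour via φ z), would then be too long, so V_x^y is convex. Distances in
-- the induced subgraph on a convex set agree with those of G, and a
-- reflection σ from a to b fixes each vertex w of the set or maps it to a
-- neighbour on a geodesic from w to a or b, so σ restricts to the subgraph.
module Submission where

open import Defs
open import Data.Bool using (Bool; T)
open import Data.Bool.Properties using (T-irrelevant)
open import Data.Nat using (ℕ; zero; suc; _+_; _≤_; _<_; z≤n; s≤s; s≤s⁻¹)
open import Data.Nat.Properties
  using ( ≤-antisym; ≤-trans; <-cmp; <-asym; <-irrefl; <-≤-trans; ≤-<-trans
        ; +-mono-≤; +-mono-<; module ≤-Reasoning)
import Data.Fin.Properties as Fin
open import Data.Product using (Σ; _×_; _,_; proj₁; proj₂; ∃; ∃-syntax)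
open import Data.Empty using (⊥-elim)
open import Function using (_∘_)
open import Function.Bundles using (Inverse)
open import Function.Properties.Inverse using (↔⇒↣)
open import Relation.Nullary using (Dec; yes; no)
open import Relation.Nullary.Decidable using (_×-dec_; via-injection)
open import Relation.Binary using (DecidableEquality; tri<; tri≈; tri>)
open import Relation.Binary.PropositionalEquality
  using (_≡_; refl; cong; subst; subst₂; trans) renaming (sym to ≡-sym)

module _ {G : Graph} where

  _++ʷ_ : ∀ {u v w i j} → Walk G u v i → Walk G v w j → Walk G u w (i + j)
  nil      ++ʷ q = q
  cons a p ++ʷ q = cons a (p ++ʷ q)

  _∷ʳʷ_ : ∀ {u v w i} → Walk G u v i → Adj G v w → Walk G u w (suc i)
  nil      ∷ʳʷ a = cons a nil
  cons b p ∷ʳʷ a = cons b (p ∷ʳʷ a)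

  reverseʷ : ∀ {u v i} → Walk G u v i → Walk G v u i
  reverseʷ nil        = nil
  reverseʷ (cons a p) = reverseʷ p ∷ʳʷ sym G a

  mapʷ : (f : V G → V G) → (∀ u v → Adj G u v → Adj G (f u) (f v)) →
         ∀ {u v k} → Walk G u v k → Walk G (f u) (f v) k
  mapʷ f f-adj nil        = nil
  mapʷ f f-adj (cons a p) = cons (f-adj _ _ a) (mapʷ f f-adj p)

  source-∈ᵂ : ∀ {u v k} (p : Walk G u v k) → u ∈ᵂ p
  source-∈ᵂ nil        = here-nil refl
  source-∈ᵂ (cons a p) = here-cons refl

  splitʷ : ∀ {u v k z} (p : Walk G u v k) → z ∈ᵂ p →
           ∃[ i ] ∃[ j ] Walk G u z i × Walk G z v j × i + j ≡ k
  splitʷ nil        (here-nil refl)  = 0 , 0 , nil , nil , refl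
  splitʷ (cons a p) (here-cons refl) = 0 , _ , nil , cons a p , refl
  splitʷ (cons a p) (there z∈p) with splitʷ p z∈p
  ... | i , j , q , r , i+j≡k = suc i , j , cons a q , r , cong suc i+j≡k

  Walk-0⇒≡ : ∀ {u v} → Walk G u v 0 → u ≡ v
  Walk-0⇒≡ nil = refl

least-witness : {P : ℕ → Set} → (∀ k → Dec (P k)) → ∀ {m} → P m →
                ∃[ k ] P k × (∀ j → P j → k ≤ j)
least-witness P? {zero} p = 0 , p , λ _ _ → z≤n
least-witness P? {suc m} p with P? 0
... | yes p0 = 0 , p0 , λ _ _ → z≤n
... | no ¬p0 with least-witness (P? ∘ suc) {m} p
... | k , pk , k-least = suc k , pk , λ { zero p0 → ⊥-elim (¬p0 p0) ; (suc j) pj → s≤s (k-least j pj) }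

module Metric (G : Graph) (fin : Finite G) (conn : Connected G) where

  open Inverse (proj₂ fin) using (to; from; strictlyInverseʳ)

  ∃? : {P : V G → Set} → (∀ w → Dec (P w)) → Dec (∃ P)
  ∃? {P} P? with Fin.any? (P? ∘ from)
  ... | yes (i , p) = yes (from i , p)
  ... | no ¬p       = no λ (w , p) → ¬p (to w , subst P (≡-sym (strictlyInverseʳ w)) p)

  _≟_ : DecidableEquality (V G)
  _≟_ = via-injection (↔⇒↣ (proj₂ fin)) Fin._≟_

  Walk? : ∀ k u v → Dec (Walk G u v k)
  Walk? zero u v with u ≟ v
  ... | yes refl = yes nil
  ... | no u≢v   = no λ { nil → u≢v refl }
  Walk? (suc k) u v with ∃? (λ w → dec G u w ×-dec Walk? k w v)
  ... | yes (w , a , p) = yes (cons a p)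
  ... | no ∄            = no λ { (cons a p) → ∄ (_ , a , p) }

  shortest : ∀ u v → Σ ℕ (Dist G u v)
  shortest u v = least-witness (λ k → Walk? k u v) (proj₂ (conn u v))

  d : V G → V G → ℕ
  d u v = proj₁ (shortest u v)

  d-Dist : ∀ u v → Dist G u v (d u v)
  d-Dist u v = proj₂ (shortest u v)

  geodesic : ∀ u v → Walk G u v (d u v)
  geodesic u v = proj₁ (d-Dist u v)

  d-minimal : ∀ {u v m} → Walk G u v m → d u v ≤ m
  d-minimal {u} {v} p = proj₂ (d-Dist u v) _ p

  Dist⇒≡d : ∀ {u v k} → Dist G u v k → d u v ≡ k
  Dist⇒≡d {u} {v} (p , p-min) = ≤-antisym (d-minimal p) (p-min _ (geodesic u v))

  d-sym : ∀ u v → d u v ≡ d v u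
  d-sym u v = ≤-antisym (d-minimal (reverseʷ (geodesic v u))) (d-minimal (reverseʷ (geodesic u v)))

  d-triangle : ∀ u w v → d u v ≤ d u w + d w v
  d-triangle u w v = d-minimal (geodesic u w ++ʷ geodesic w v)

  d-adj : ∀ {u w} v → Adj G u w → d u v ≤ suc (d w v)
  d-adj v a = d-minimal (cons a (geodesic _ v))

  d≡0⇒≡ : ∀ {u v} → d u v ≡ 0 → u ≡ v
  d≡0⇒≡ {u} {v} e = Walk-0⇒≡ (subst (Walk G u v) e (geodesic u v))

  ∈-geodesic⇒d+d≤d : ∀ {u v k z} (p : Walk G u v k) → Dist G u v k → z ∈ᵂ p →
                     d u z + d z v ≤ d u v
  ∈-geodesic⇒d+d≤d {u} {v} {z = z} p D z∈p with splitʷ p z∈p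
  ... | i , j , q , r , refl =
    subst (d u z + d z v ≤_) (≡-sym (Dist⇒≡d D)) (+-mono-≤ (d-minimal q) (d-minimal r))

  next-towards : ∀ {w x k} → d w x ≡ suc k → ∃[ w′ ] Adj G w w′ × d w′ x ≡ k
  next-towards {w} {x} e with subst (Walk G w x) e (geodesic w x)
  ... | cons {w = w′} a p = w′ , a , ≤-antisym (d-minimal p) (s≤s⁻¹ (subst (_≤ _) e (d-adj x a)))

  convex-step : ∀ {W w t c} → Convex G W → Adj G w t → d w c ≡ suc (d t c) → W w → W c → W t
  convex-step {w = w} {t} {c} W-convex a e w∈W c∈W =
    W-convex (cons a (geodesic t c)) (subst (Dist G w c) e (d-Dist w c)) w∈W c∈W t (there (source-∈ᵂ _))

  Isometry : (V G → V G) → Set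
  Isometry f = ∀ u v → d (f u) (f v) ≡ d u v

  involutive-automorphism⇒isometry : ∀ {f} → (∀ u v → Adj G u v → Adj G (f u) (f v)) →
                                     (∀ u → f (f u) ≡ u) → Isometry f
  involutive-automorphism⇒isometry {f} f-adj f-inv u v = ≤-antisym
    (d-minimal (mapʷ f f-adj (geodesic u v)))
    (d-minimal (subst₂ (λ a b → Walk G a b (d (f u) (f v))) (f-inv u) (f-inv v) (mapʷ f f-adj (geodesic (f u) (f v)))))

  -- V_a^b, stated with the computed distance instead of Dist witnesses.
  Nearer : V G → V G → V G → Set
  Nearer a b w = d w a < d w b

  Side⇒Nearer : ∀ {a b w} → Side G a b w → Nearer a b w
  Side⇒Nearer (_ , _ , Da , Db , lt) = subst₂ _<_ (≡-sym (Dist⇒≡d Da)) (≡-sym (Dist⇒≡d Db)) lt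

  Nearer⇒Side : ∀ {a b w} → Nearer a b w → Side G a b w
  Nearer⇒Side {a} {b} {w} lt = _ , _ , d-Dist w a , d-Dist w b , lt

  Mid⇒≡ : ∀ {a b w} → Mid G a b w → d w a ≡ d w b
  Mid⇒≡ (_ , Da , Db) = trans (Dist⇒≡d Da) (≡-sym (Dist⇒≡d Db))

  ≡⇒Mid : ∀ {a b w} → d w a ≡ d w b → Mid G a b w
  ≡⇒Mid {a} {b} {w} e = d w a , d-Dist w a , subst (Dist G w b) (≡-sym e) (d-Dist w b)

  Nearer-step : ∀ {x y w w′} → Adj G w w′ → d w x ≡ suc (d w′ x) → Nearer x y w → Nearer x y w′
  Nearer-step {x} {y} {w} a e w-near = s≤s⁻¹ (≤-trans (subst (_< d w y) e w-near) (d-adj y a))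

  isometry-swaps-Nearer : ∀ {f x y w} → Isometry f → f x ≡ y → f y ≡ x → Nearer x y w → Nearer y x (f w)
  isometry-swaps-Nearer {f} {x} {y} {w} f-iso fx≡y fy≡x =
    subst₂ _<_ (≡-sym (trans (cong (d (f w)) (≡-sym fx≡y)) (f-iso w x)))
               (≡-sym (trans (cong (d (f w)) (≡-sym fy≡x)) (f-iso w y)))

  module ReflectionProperties {x y φ} (R : Reflection G x y φ) where
    open Reflection R

    φ-isometry : Isometry φ
    φ-isometry = involutive-automorphism⇒isometry adj-pres involution

    φ-y : φ y ≡ x
    φ-y = trans (cong φ (≡-sym maps)) (involution x)

    φ-swaps : ∀ {w} → Nearer y x w → Nearer x y (φ w)
    φ-swaps = isometry-swaps-Nearer φ-isometry φ-y maps

    φ-step : ∀ {w} → Nearer x y w → Adj G w (φ w) × d w y ≡ suc (d (φ w) y)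
    φ-step {w} w-near = w∼φw , ≤-antisym (d-adj y w∼φw) (subst (λ t → suc t ≤ d w y) (≡-sym φw-y) w-near)
      where
        w∼φw : Adj G w (φ w)
        w∼φw = proj₂ (cut-mem w (Nearer⇒Side w-near))
        φw-y : d (φ w) y ≡ d w x
        φw-y = trans (cong (d (φ w)) (≡-sym maps)) (φ-isometry w x)

  reflection-sym : ∀ {x y φ} → Reflection G x y φ → Reflection G y x φ
  reflection-sym {x} {y} {φ} R = record
    { adj-pres   = adj-pres
    ; adj-refl   = adj-refl
    ; involution = involution
    ; maps       = φ-y
    ; cut-mem    = λ u u-side →
        let φu-near = φ-swaps (Side⇒Nearer u-side)
        in Nearer⇒Side φu-near
         , sym G (subst (Adj G (φ u)) (involution u) (proj₂ (cut-mem (φ u) (Nearer⇒Side φu-near))))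
    ; cut-only   = λ u v u-side v-side a →
        ≡-sym (trans (cong φ (cut-only v u v-side u-side (sym G a))) (involution v))
    ; fixes      = λ { z (k , Dy , Dx) → fixes z (k , Dx , Dy) }
    }
    where
      open Reflection R
      open ReflectionProperties R

  reflection-preserves-convex : ∀ {W a b σ} → Convex G W → Reflection G a b σ →
                                W a → W b → ∀ w → W w → W (σ w)
  reflection-preserves-convex {W} {a} {b} W-convex R a∈W b∈W w w∈W with <-cmp (d w a) (d w b)
  ... | tri< lt _ _ =
    let (w∼σw , e) = ReflectionProperties.φ-step R lt in convex-step W-convex w∼σw e w∈W b∈W
  ... | tri≈ _ eq _ = subst W (≡-sym (Reflection.fixes R w (≡⇒Mid eq))) w∈W
  ... | tri> _ _ gt =
    let (w∼σw , e) = ReflectionProperties.φ-step (reflection-sym R) gt in convex-step W-convex w∼σw e w∈W a∈W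

  module HalfSpace (rf : Reflective G) {x y : V G} (xy : Adj G x y) where

    φ : V G → V G
    φ = proj₁ (rf x y xy)

    open Reflection (proj₂ (rf x y xy))
    open ReflectionProperties (proj₂ (rf x y xy))

    Nearer-x⊆Nearer-v : ∀ {v w} → Nearer x y v → Nearer x y w → Nearer v (φ v) w
    Nearer-x⊆Nearer-v {v} {w} v-near = induct (d w x) w refl
      where
        v∼φv : Adj G v (φ v)
        v∼φv = proj₂ (cut-mem v (Nearer⇒Side v-near))

        ρ : V G → V G
        ρ = proj₁ (rf v (φ v) v∼φv)

        module ρ = Reflection (proj₂ (rf v (φ v) v∼φv))
        module ρP = ReflectionProperties (proj₂ (rf v (φ v) v∼φv))

        x-near-v : Nearer v (φ v) x
        x-near-v = subst₂ _<_ (d-sym v x)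
          (≡-sym (trans (cong (λ t → d t (φ v)) (≡-sym φ-y)) (trans (φ-isometry y v) (d-sym y v)))) v-near

        y-near-φv : Nearer (φ v) v y
        y-near-φv = subst₂ _<_
          (≡-sym (trans (cong (λ t → d t (φ v)) (≡-sym maps)) (trans (φ-isometry x v) (d-sym x v))))
          (d-sym v y) v-near

        ρ-x : ρ x ≡ y
        ρ-x = ≡-sym (ρ.cut-only x y (Nearer⇒Side x-near-v) (Nearer⇒Side y-near-φv) xy)

        ρ-swaps : ∀ {u} → Nearer x y u → Nearer y x (ρ u)
        ρ-swaps = isometry-swaps-Nearer ρP.φ-isometry ρ-x (trans (cong ρ (≡-sym ρ-x)) (ρ.involution x))

        induct : ∀ k u → d u x ≡ k → Nearer x y u → Nearer v (φ v) u
        induct zero u e _ = subst (Nearer v (φ v)) (≡-sym (d≡0⇒≡ e)) x-near-v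
        induct (suc k) u e u-near with next-towards e
        ... | u′ , u∼u′ , e′ with <-cmp (d u v) (d u (φ v))
        ... | tri< lt _ _ = lt
        ... | tri≈ _ eq _ = ⊥-elim (<-asym u-near (subst (Nearer y x) (ρ.fixes u (≡⇒Mid eq)) (ρ-swaps u-near)))
        ... | tri> _ _ gt = ⊥-elim (<-asym u-near (subst (Nearer y x) (≡-sym u≡ρu′) (ρ-swaps u′-near)))
          where
            u′-near : Nearer x y u′
            u′-near = Nearer-step u∼u′ (trans e (cong suc (≡-sym e′))) u-near
            u≡ρu′ : u ≡ ρ u′
            u≡ρu′ = ρ.cut-only u′ u (Nearer⇒Side (induct k u′ e′ u′-near)) (Nearer⇒Side gt) (sym G u∼u′)

    fixed-point-detour : ∀ {u v z} → Nearer x y u → Nearer x y v → φ z ≡ z → d u v < d u z + d z v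
    fixed-point-detour {u} {v} {z} u-near v-near φz≡z = <-≤-trans (Nearer-x⊆Nearer-v v-near u-near) (begin
      d u (φ v)             ≤⟨ d-triangle u z (φ v) ⟩
      d u z + d z (φ v)     ≡⟨ cong (λ t → d u z + d t (φ v)) (≡-sym φz≡z) ⟩
      d u z + d (φ z) (φ v) ≡⟨ cong (d u z +_) (φ-isometry z v) ⟩
      d u z + d z v         ∎)
      where open ≤-Reasoning

    far-side-detour : ∀ {u v z} → Nearer x y u → Nearer x y v → Nearer y x z → d u v < d u z + d z v
    far-side-detour {u} {v} {z} u-near v-near z-far = ≤-<-trans (d-triangle u (φ z) v)
      (+-mono-< (closer u-near) (subst₂ _<_ (d-sym v (φ z)) (d-sym v z) (closer v-near)))
      where
        closer : ∀ {t} → Nearer x y t → d t (φ z) < d t z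
        closer {t} t-near =
          subst (d t (φ z) <_) (cong (d t) (involution z)) (Nearer-x⊆Nearer-v (φ-swaps z-far) t-near)

    Side-convex : Convex G (Side G x y)
    Side-convex p D u-side v-side z z∈p with <-cmp (d z x) (d z y)
    ... | tri< lt _ _ = Nearer⇒Side lt
    ... | tri≈ _ eq _ = ⊥-elim (<-irrefl refl (<-≤-trans
            (fixed-point-detour (Side⇒Nearer u-side) (Side⇒Nearer v-side) (fixes z (≡⇒Mid eq)))
            (∈-geodesic⇒d+d≤d p D z∈p)))
    ... | tri> _ _ gt = ⊥-elim (<-irrefl refl (<-≤-trans
            (far-side-detour (Side⇒Nearer u-side) (Side⇒Nearer v-side) gt)
            (∈-geodesic⇒d+d≤d p D z∈p)))

  module ConvexSubgraph (S : V G → Bool) (S-convex : Convex G (T ∘ S)) where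

    H : Graph
    H = Induced G S

    Σ-≡ : ∀ {u v} {su : T (S u)} {sv : T (S v)} → u ≡ v → _≡_ {A = V H} (u , su) (v , sv)
    Σ-≡ {u} refl = cong (u ,_) (T-irrelevant _ _)

    forget : ∀ {p q k} → Walk H p q k → Walk G (proj₁ p) (proj₁ q) k
    forget nil        = nil
    forget (cons a w) = cons a (forget w)

    lift : ∀ {u v k} (p : Walk G u v k) → (∀ z → z ∈ᵂ p → T (S z)) →
           (su : T (S u)) (sv : T (S v)) → Walk H (u , su) (v , sv) k
    lift {u} nil _ su sv = subst (λ s → Walk H (u , su) (u , s) 0) (T-irrelevant su sv) nil
    lift (cons {w = w} a p) p⊆S su sv =
      cons a (lift p (λ z z∈p → p⊆S z (there z∈p)) (p⊆S w (there (source-∈ᵂ p))) sv)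

    d-Distᴴ : ∀ p q → Dist H p q (d (proj₁ p) (proj₁ q))
    d-Distᴴ (u , su) (v , sv) =
      lift (geodesic u v) (S-convex (geodesic u v) (d-Dist u v) su sv) su sv ,
      λ _ w → d-minimal (forget w)

    Distᴴ⇒≡d : ∀ {p q k} → Dist H p q k → k ≡ d (proj₁ p) (proj₁ q)
    Distᴴ⇒≡d {p} {q} (w , w-min) = ≤-antisym (w-min _ (proj₁ (d-Distᴴ p q))) (d-minimal (forget w))

    Sideᴴ⇒Side : ∀ {a b w} → Side H a b w → Side G (proj₁ a) (proj₁ b) (proj₁ w)
    Sideᴴ⇒Side (_ , _ , Da , Db , lt) = Nearer⇒Side (subst₂ _<_ (Distᴴ⇒≡d Da) (Distᴴ⇒≡d Db) lt)

    Side⇒Sideᴴ : ∀ {a b w} → Side G (proj₁ a) (proj₁ b) (proj₁ w) → Side H a b w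
    Side⇒Sideᴴ {a} {b} {w} s = _ , _ , d-Distᴴ w a , d-Distᴴ w b , Side⇒Nearer s

    Midᴴ⇒Mid : ∀ {a b w} → Mid H a b w → Mid G (proj₁ a) (proj₁ b) (proj₁ w)
    Midᴴ⇒Mid (_ , Da , Db) = ≡⇒Mid (trans (≡-sym (Distᴴ⇒≡d Da)) (Distᴴ⇒≡d Db))

    restrict : ∀ {a b σ} (R : Reflection G a b σ) (sa : T (S a)) (sb : T (S b)) →
               Reflection H (a , sa) (b , sb)
                 (λ (w , sw) → σ w , reflection-preserves-convex S-convex R sa sb w sw)
    restrict R sa sb = record
      { adj-pres   = λ u v → adj-pres (proj₁ u) (proj₁ v)
      ; adj-refl   = λ u v → adj-refl (proj₁ u) (proj₁ v)
      ; involution = λ u → Σ-≡ (involution (proj₁ u))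
      ; maps       = Σ-≡ maps
      ; cut-mem    = λ u u-side →
          let (σu-side , u∼σu) = cut-mem (proj₁ u) (Sideᴴ⇒Side u-side) in Side⇒Sideᴴ σu-side , u∼σu
      ; cut-only   = λ u v u-side v-side a →
          Σ-≡ (cut-only (proj₁ u) (proj₁ v) (Sideᴴ⇒Side u-side) (Sideᴴ⇒Side v-side) a)
      ; fixes      = λ z z-mid → Σ-≡ (fixes (proj₁ z) (Midᴴ⇒Mid z-mid))
      }
      where open Reflection R

    Induced-reflective : Reflective G → Reflective H
    Induced-reflective rf (a , sa) (b , sb) ab = _ , restrict (proj₂ (rf a b ab)) sa sb

lemma2p9 : (G : Graph) → Finite G → Connected G → Reflective G →
    (x y : V G) → Adj G x y →
    Convex G (Side G x y) ×
    ((S : V G → Bool) → (∀ v → T (S v) → Side G x y v) → (∀ v → Side G x y v → T (S v)) →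
    Reflective (Induced G S))
lemma2p9 G fin conn rf x y xy = Side-convex , λ S S⊆Side Side⊆S →
  ConvexSubgraph.Induced-reflective S
    (λ p D su sv z z∈p → Side⊆S z (Side-convex p D (S⊆Side _ su) (S⊆Side _ sv) z z∈p)) rf
  where
    open Metric G fin conn
    open HalfSpace rf xy
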